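{- Let $k \ge 3$ be an integer and let $D$ be a $k$-partite tournament. Then the stability number (maximum size of a set of pairwise nonadjacent vertices) of the niche graph $\mathcal{N}(D)$ is at most $3$.
   Context: A $k$-partite tournament is an orientation of a complete $k$-partite graph with $k$ nonempty partite sets. The niche graph $\mathcal{N}(D)$ of a digraph $D$ has vertex set $V(D)$, and two distinct vertices $u,v$ are adjacent iff they have a common out-neighbor in $D$ or a common in-neighbor in $D$. -}

module Defs where

open import Data.Nat using (ℕ; _≤_)
open import Data.Fin using (Fin)
open import Data.Product using (Σ; _×_; ∃)
open import Data.Sum using (_⊎_)
open import Data.List using (List; length)
open import Data.List.Membership.Propositional using (_∈_)
open import Data.List.Relation.Unary.Unique.Propositional using (Unique)
open import Relation.Binary.PropositionalEquality using (_≡_)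
open import Relation.Nullary using (¬_)

record Digraph (n : ℕ) : Set₁ where
  field
    arc : Fin n → Fin n → Set

open Digraph public

record IsMultipartiteTournament {n : ℕ} (k : ℕ) (D : Digraph n) : Set₁ where
  field
    part          : Fin n → Fin k
    nonempty      : (i : Fin k) → ∃ λ v → part v ≡ i
    noArcInside   : (u v : Fin n) → part u ≡ part v → ¬ arc D u v
    oriented      : (u v : Fin n) → ¬ part u ≡ part v → arc D u v ⊎ arc D v u
    antisymmetric : (u v : Fin n) → arc D u v → ¬ arc D v u

NicheAdj : {n : ℕ} → Digraph n → Fin n → Fin n → Set
NicheAdj D u v =
  ¬ u ≡ v ×
  ((∃ λ w → arc D u w × arc D v w) ⊎ (∃ λ w → arc D w u × arc D w v))

IsStableSet : {n : ℕ} → (Fin n → Fin n → Set) → List (Fin n) → Set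
IsStableSet adj S = Unique S × (∀ {u v} → u ∈ S → v ∈ S → ¬ adj u v)

StabilityNumber≤ : {n : ℕ} → (Fin n → Fin n → Set) → ℕ → Set
StabilityNumber≤ adj m = ∀ S → IsStableSet adj S → length S ≤ m

-- If w lies outside the partite sets of x, y and z, then each of x, y, z is an
-- in- or an out-neighbour of w, so two of them share w as a common neighbour.
-- Hence three pairwise nonadjacent vertices of N(D) meet every partite set;
-- with k ≥ 3 partite sets they lie in three distinct ones. For a stable set
-- {a, b, c, d}, the triple {a, b, d} must then meet the partite set of c, and
-- it can only do so through d, contradicting that {a, c, d} are in distinct parts.
module Submission where

open import Defs
open import Data.Nat using (ℕ; suc; _≤_; z≤n; s≤s)
open import Data.Fin using (Fin; _≟_) renaming (zero to 0F; suc to sucF)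
open import Data.Product using (_×_; ∃; _,_)
open import Data.Sum using (_⊎_; inj₁; inj₂; [_,_])
open import Data.Empty using (⊥; ⊥-elim)
open import Data.List using ([]; _∷_)
open import Data.List.Membership.Propositional using (_∈_)
open import Data.List.Relation.Unary.Any using (here; there)
open import Data.List.Relation.Unary.All using (_∷_)
open import Data.List.Relation.Unary.AllPairs using (_∷_)
open import Relation.Binary.PropositionalEquality using (_≡_; refl; sym)
open import Relation.Nullary using (¬_; yes; no)

SharesNeighbour : {n : ℕ} → Digraph n → Fin n → Fin n → Set
SharesNeighbour D u v =
  (∃ λ w → arc D u w × arc D v w) ⊎ (∃ λ w → arc D w u × arc D w v)

module _ {n : ℕ} {D : Digraph n} where

  stable⇒¬SharesNeighbour : ∀ {S u v} → IsStableSet (NicheAdj D) S →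
    u ∈ S → v ∈ S → ¬ u ≡ v → ¬ SharesNeighbour D u v
  stable⇒¬SharesNeighbour (_ , nonadjacent) u∈S v∈S u≢v shared =
    nonadjacent u∈S v∈S (u≢v , shared)

  module _ {k : ℕ} (T : IsMultipartiteTournament k D) where
    open IsMultipartiteTournament T

    no-three-unshared-outside-part : ∀ {w x y z} →
      ¬ SharesNeighbour D x y → ¬ SharesNeighbour D x z → ¬ SharesNeighbour D y z →
      ¬ part x ≡ part w → ¬ part y ≡ part w → ¬ part z ≡ part w → ⊥
    no-three-unshared-outside-part {w} {x} {y} {z} x∤y x∤z y∤z x∉w y∉w z∉w
      with oriented x w x∉w | oriented y w y∉w | oriented z w z∉w
    ... | inj₁ xw | inj₁ yw | _      = x∤y (inj₁ (w , xw , yw))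
    ... | inj₂ wx | inj₂ wy | _      = x∤y (inj₂ (w , wx , wy))
    ... | inj₁ xw | _      | inj₁ zw = x∤z (inj₁ (w , xw , zw))
    ... | inj₂ wx | _      | inj₂ wz = x∤z (inj₂ (w , wx , wz))
    ... | _      | inj₁ yw | inj₁ zw = y∤z (inj₁ (w , yw , zw))
    ... | _      | inj₂ wy | inj₂ wz = y∤z (inj₂ (w , wy , wz))

    unshared-triple-meets-every-part : ∀ {x y z} →
      ¬ SharesNeighbour D x y → ¬ SharesNeighbour D x z → ¬ SharesNeighbour D y z →
      ∀ i → part x ≡ i ⊎ part y ≡ i ⊎ part z ≡ i
    unshared-triple-meets-every-part {x} {y} {z} x∤y x∤z y∤z i with nonempty i
    ... | w , refl with part x ≟ part w | part y ≟ part w | part z ≟ part w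
    ... | yes x∈w | _       | _       = inj₁ x∈w
    ... | no _    | yes y∈w | _       = inj₂ (inj₁ y∈w)
    ... | no _    | no _    | yes z∈w = inj₂ (inj₂ z∈w)
    ... | no x∉w  | no y∉w  | no z∉w  =
      ⊥-elim (no-three-unshared-outside-part x∤y x∤z y∤z x∉w y∉w z∉w)

two-values-cannot-cover : ∀ {k} (p q : Fin (suc (suc (suc k)))) →
  ¬ (∀ i → p ≡ i ⊎ q ≡ i)
two-values-cannot-cover p q cover with cover 0F | cover (sucF 0F) | cover (sucF (sucF 0F))
... | inj₁ refl | inj₁ ()   | _
... | inj₂ refl | inj₂ ()   | _
... | inj₁ refl | inj₂ refl | inj₁ ()
... | inj₁ refl | inj₂ refl | inj₂ ()
... | inj₂ refl | inj₁ refl | inj₁ ()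
... | inj₂ refl | inj₁ refl | inj₂ ()

three-covering-values-distinct : ∀ {k} {p q r : Fin (suc (suc (suc k)))} →
  (∀ i → p ≡ i ⊎ q ≡ i ⊎ r ≡ i) → ¬ p ≡ q × ¬ p ≡ r × ¬ q ≡ r
three-covering-values-distinct {p = p} {q} {r} cover =
  (λ { refl → two-values-cannot-cover p r λ i → [ inj₁ , [ inj₁ , inj₂ ] ] (cover i) }) ,
  (λ { refl → two-values-cannot-cover p q λ i → [ inj₁ , [ inj₂ , inj₁ ] ] (cover i) }) ,
  (λ { refl → two-values-cannot-cover p q λ i → [ inj₁ , [ inj₂ , inj₂ ] ] (cover i) })

module _ {k n : ℕ} {D : Digraph n} (T : IsMultipartiteTournament (suc (suc (suc k))) D) where
  open IsMultipartiteTournament T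

  unshared-triple-parts-distinct : ∀ {x y z} →
    ¬ SharesNeighbour D x y → ¬ SharesNeighbour D x z → ¬ SharesNeighbour D y z →
    ¬ part x ≡ part y × ¬ part x ≡ part z × ¬ part y ≡ part z
  unshared-triple-parts-distinct x∤y x∤z y∤z =
    three-covering-values-distinct (unshared-triple-meets-every-part T x∤y x∤z y∤z)

  no-unshared-quadruple : ∀ {a b c d} →
    ¬ SharesNeighbour D a b → ¬ SharesNeighbour D a c → ¬ SharesNeighbour D a d →
    ¬ SharesNeighbour D b c → ¬ SharesNeighbour D b d → ¬ SharesNeighbour D c d → ⊥
  no-unshared-quadruple {c = c} a∤b a∤c a∤d b∤c b∤d c∤d =
    part-c-unmet (unshared-triple-parts-distinct a∤b a∤c b∤c)
                 (unshared-triple-parts-distinct a∤c a∤d c∤d)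
                 (unshared-triple-meets-every-part T a∤b a∤d b∤d (part c))
    where
    part-c-unmet : ∀ {pa pb pc pd : Fin (suc (suc (suc k)))} →
      ¬ pa ≡ pb × ¬ pa ≡ pc × ¬ pb ≡ pc → ¬ pa ≡ pc × ¬ pa ≡ pd × ¬ pc ≡ pd →
      ¬ (pa ≡ pc ⊎ pb ≡ pc ⊎ pd ≡ pc)
    part-c-unmet (_ , a∉c , _) _           (inj₁ a∈c)        = a∉c a∈c
    part-c-unmet (_ , _ , b∉c) _           (inj₂ (inj₁ b∈c)) = b∉c b∈c
    part-c-unmet _           (_ , _ , c∉d) (inj₂ (inj₂ d∈c)) = c∉d (sym d∈c)

  no-stable-quadruple : ∀ {a b c d S} → ¬ IsStableSet (NicheAdj D) (a ∷ b ∷ c ∷ d ∷ S)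
  no-stable-quadruple {a} {b} {c} {d} {S}
    stable@(((a≢b ∷ a≢c ∷ a≢d ∷ _) ∷ (b≢c ∷ b≢d ∷ _) ∷ (c≢d ∷ _) ∷ _) , _) =
    no-unshared-quadruple (apart a∈ b∈ a≢b) (apart a∈ c∈ a≢c) (apart a∈ d∈ a≢d)
                          (apart b∈ c∈ b≢c) (apart b∈ d∈ b≢d) (apart c∈ d∈ c≢d)
    where
    a∈ : a ∈ a ∷ b ∷ c ∷ d ∷ S
    a∈ = here refl
    b∈ : b ∈ a ∷ b ∷ c ∷ d ∷ S
    b∈ = there (here refl)
    c∈ : c ∈ a ∷ b ∷ c ∷ d ∷ S
    c∈ = there (there (here refl))
    d∈ : d ∈ a ∷ b ∷ c ∷ d ∷ S
    d∈ = there (there (there (here refl)))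
    apart : ∀ {u v} → u ∈ a ∷ b ∷ c ∷ d ∷ S → v ∈ a ∷ b ∷ c ∷ d ∷ S → ¬ u ≡ v →
      ¬ SharesNeighbour D u v
    apart = stable⇒¬SharesNeighbour stable

theorem2p7 : (k : ℕ) → 3 ≤ k → (n : ℕ) → (D : Digraph n) →
    IsMultipartiteTournament k D → StabilityNumber≤ (NicheAdj D) 3
theorem2p7 _ (s≤s (s≤s (s≤s _))) _ _ _ []                    _ = z≤n
theorem2p7 _ (s≤s (s≤s (s≤s _))) _ _ _ (_ ∷ [])              _ = s≤s z≤n
theorem2p7 _ (s≤s (s≤s (s≤s _))) _ _ _ (_ ∷ _ ∷ [])          _ = s≤s (s≤s z≤n)
theorem2p7 _ (s≤s (s≤s (s≤s _))) _ _ _ (_ ∷ _ ∷ _ ∷ [])      _ = s≤s (s≤s (s≤s z≤n))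
theorem2p7 _ (s≤s (s≤s (s≤s _))) _ _ T (_ ∷ _ ∷ _ ∷ _ ∷ _) stable =
  ⊥-elim (no-stable-quadruple T stable)
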